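{- For all integers $n,r,j\ge 1$, $$p^r_j(n)=p^{r-1}_j(n)+\sum_{s=0}^{n-1}\binom{n}{s}\,p^{r-1}_j(s).$$
   Context: A preferential arrangement of a finite set $S$ is an ordered set partition of $S$ (a sequence of nonempty pairwise disjoint blocks with union $S$); the empty set has exactly one. Let $a(w)$ be the number of preferential arrangements of a $w$-element set ($a(0)=1$). A barred preferential arrangement of $X_n=\{1,\dots,n\}$ with $k$ bars is a sequence of $k+1$ possibly empty, pairwise disjoint sections with union $X_n$, each equipped with a preferential arrangement of its elements. A restricted section is one whose preferential arrangement has at most one block (exactly one choice); a free section may carry any preferential arrangement. For integers $r,j\ge0$ with $r+j\ge1$, $p^r_j(n)$ is the number of barred preferential arrangements of $X_n$ with $r+j$ sections ($r+j-1$ bars) in which $r$ fixed sections are restricted and $j$ fixed sections are free; equivalently $p^r_j(n)=\sum_{w_1+\cdots+w_{r+j}=n}\frac{n!}{w_1!\cdots w_{r+j}!}\prod_{i=r+1}^{r+j}a(w_i)$ (sum over nonnegative integer solutions). -}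

module Defs where

open import Data.Nat using (ℕ; zero; suc; _+_; _*_; _∸_; _/_; NonZero; _!)
open import Data.Nat.Combinatorics using (_C_)
open import Data.Nat.ListAction using (sum; product)
open import Data.Nat.Properties using (m*n≢0; _!≢0)
open import Data.Product using (_×_; _,_; proj₁; proj₂)
open import Data.List using (List; []; _∷_; map; concatMap; upTo; zip; take; drop)

Σ< : ℕ → (ℕ → ℕ) → ℕ
Σ< n f = sum (map f (upTo n))

-- a(w): number of preferential arrangements (ordered set partitions) of a
-- w-element set.  Choosing the first block (of size k ≥ 1):
--   a(0) = 1,   a(n) = Σ_{k=1}^{n} C(n,k) a(n-k).
-- aTable n = [a(n), a(n-1), …, a(0)]  (structural recursion).

aStep : ℕ → List ℕ → ℕ
-- aStep n [a(n-1),…,a(0)] = Σ_{i<n} C(n,i+1) · a(n-1-i)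
aStep n L = sum (map (λ p → (n C suc (proj₁ p)) * proj₂ p) (zip (upTo n) L))

aTable : ℕ → List ℕ
aTable zero = 1 ∷ []
aTable (suc n) = aStep (suc n) (aTable n) ∷ aTable n

a : ℕ → ℕ
a n with aTable n
... | []    = 0   -- unreachable
... | x ∷ _ = x

compositions : (m n : ℕ) → List (List ℕ)
compositions zero zero    = [] ∷ []
compositions zero (suc _) = []
compositions (suc m) n =
  concatMap (λ w → map (w ∷_) (compositions m (n ∸ w))) (upTo (suc n))

prod! : List ℕ → ℕ
prod! [] = 1
prod! (w ∷ ws) = (w !) * prod! ws

prod!≢0 : (ws : List ℕ) → NonZero (prod! ws)
prod!≢0 [] = _
prod!≢0 (w ∷ ws) = m*n≢0 (w !) (prod! ws) {{w !≢0}} {{prod!≢0 ws}}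

multinomial : ℕ → List ℕ → ℕ
multinomial n ws = _/_ (n !) (prod! ws) {{prod!≢0 ws}}

-- p^r_j(n): barred preferential arrangements of X_n with r+j sections,
-- the first r restricted (weight 1), the last j free (weight a(w)):
--   p^r_j(n) = Σ_{w₁+⋯+w_{r+j}=n} n!/(w₁!⋯w_{r+j}!) · Π_{i=r+1}^{r+j} a(w_i)

p : (r j n : ℕ) → ℕ
p r j n = sum (map (λ ws → multinomial n ws * product (map a (drop r ws)))
                   (compositions (r + j) n))

-- Classifying the arrangements counted by p^{r+1}_j(n) by the number w of elements in the first
-- (restricted) section gives p^{r+1}_j(n) = Σ_{w ≤ n} C(n,w) p^r_j(n-w); on the level of the formula
-- this is the factorisation of the multinomial coefficient n!/(w! w₂! ⋯) = C(n,w) · (n-w)!/(w₂! ⋯).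
-- Substituting s = n - w, using C(n,w) = C(n,s), and splitting off the term s = n gives the claim.
module Submission where

open import Defs
open import Data.Nat using (ℕ; zero; suc; _+_; _*_; _∸_; _≤_; _<_; _!; s≤s⁻¹)
open import Data.Nat.Combinatorics using (_C_; nCk≡n!/k![n-k]!; k![n∸k]!∣n!; nCk≡nC[n∸k]; nCn≡1)
open import Data.Nat.Divisibility using (_∣_; 1∣_; ∣-trans; *-monoʳ-∣)
open import Data.Nat.DivMod using (m/n*n≡m)
open import Data.Nat.ListAction using (sum; product)
open import Data.Nat.ListAction.Properties using (sum-++; sum-↭)
open import Data.Nat.Properties using (_!*_!≢0; +-comm; *-assoc; *-distribˡ-+; *-zeroʳ; *-identityˡ; *-cancelʳ-≡; +-identityʳ; m≤m+n; m+n∸m≡n; m+[n∸m]≡n)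
open import Data.Nat.Tactic.RingSolver using (solve-∀)
open import Data.List using (List; []; _∷_; _++_; [_]; map; concat; concatMap; upTo; applyUpTo; downFrom; reverse; drop)
open import Data.List.Properties using (map-∘; map-++; map-concatMap; map-cong-local; map-upTo; reverse-upTo; reverse-map; upTo-∷ʳ)
open import Data.List.Membership.Propositional using (_∈_; find)
open import Data.List.Membership.Propositional.Properties using (∈-concatMap⁻; ∈-map⁻; ∈-upTo⁻)
open import Data.List.Relation.Unary.All using (tabulate)
open import Data.List.Relation.Unary.Any using (here)
open import Data.List.Relation.Binary.Permutation.Propositional.Properties using (↭-reverse)
open import Data.Product using (_,_)
open import Function using (_∘_)
open import Relation.Binary.PropositionalEquality using (_≡_; refl; sym; trans; cong; subst; module ≡-Reasoning)
open ≡-Reasoning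

sum-map-cong-∈ : {A : Set} {f g : A → ℕ} {xs : List A} →
  (∀ {x} → x ∈ xs → f x ≡ g x) → sum (map f xs) ≡ sum (map g xs)
sum-map-cong-∈ f≡g = cong sum (map-cong-local (tabulate f≡g))

sum-map-*ˡ : {A : Set} (c : ℕ) (f : A → ℕ) (xs : List A) →
  sum (map (λ x → c * f x) xs) ≡ c * sum (map f xs)
sum-map-*ˡ c f []       = sym (*-zeroʳ c)
sum-map-*ˡ c f (x ∷ xs) = trans (cong (c * f x +_) (sum-map-*ˡ c f xs)) (sym (*-distribˡ-+ c (f x) _))

sum-concat : (xss : List (List ℕ)) → sum (concat xss) ≡ sum (map sum xss)
sum-concat []         = refl
sum-concat (xs ∷ xss) = trans (sum-++ xs (concat xss)) (cong (sum xs +_) (sum-concat xss))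

sum-map-concatMap : {A B : Set} (h : B → ℕ) (g : A → List B) (xs : List A) →
  sum (map h (concatMap g xs)) ≡ sum (map (λ x → sum (map h (g x))) xs)
sum-map-concatMap h g xs = begin
  sum (map h (concatMap g xs))            ≡⟨ cong sum (map-concatMap h g xs) ⟩
  sum (concat (map (map h ∘ g) xs))       ≡⟨ sum-concat (map (map h ∘ g) xs) ⟩
  sum (map sum (map (map h ∘ g) xs))      ≡⟨ cong sum (map-∘ xs) ⟨
  sum (map (λ x → sum (map h (g x))) xs)  ∎

Σ<-cong : ∀ n {f g : ℕ → ℕ} → (∀ {i} → i < n → f i ≡ g i) → Σ< n f ≡ Σ< n g
Σ<-cong n f≡g = sum-map-cong-∈ (f≡g ∘ ∈-upTo⁻)

Σ<-suc : ∀ n (f : ℕ → ℕ) → Σ< (suc n) f ≡ Σ< n f + f n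
Σ<-suc n f = begin
  sum (map f (upTo (suc n)))          ≡⟨ cong (sum ∘ map f) (upTo-∷ʳ n) ⟨
  sum (map f (upTo n ++ [ n ]))       ≡⟨ cong sum (map-++ f (upTo n) [ n ]) ⟩
  sum (map f (upTo n) ++ [ f n ])     ≡⟨ sum-++ (map f (upTo n)) [ f n ] ⟩
  Σ< n f + (f n + 0)                  ≡⟨ cong (Σ< n f +_) (+-identityʳ (f n)) ⟩
  Σ< n f + f n                        ∎

applyUpTo-∸ : ∀ n → applyUpTo (n ∸_) (suc n) ≡ downFrom (suc n)
applyUpTo-∸ zero    = refl
applyUpTo-∸ (suc n) = cong (suc n ∷_) (applyUpTo-∸ n)

Σ<-reflect : ∀ n (f : ℕ → ℕ) → Σ< (suc n) (λ i → f (n ∸ i)) ≡ Σ< (suc n) f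
Σ<-reflect n f = begin
  sum (map (f ∘ (n ∸_)) (upTo (suc n)))      ≡⟨ cong sum (map-∘ (upTo (suc n))) ⟩
  sum (map f (map (n ∸_) (upTo (suc n))))    ≡⟨ cong (sum ∘ map f) (map-upTo (n ∸_) (suc n)) ⟩
  sum (map f (applyUpTo (n ∸_) (suc n)))     ≡⟨ cong (sum ∘ map f) (applyUpTo-∸ n) ⟩
  sum (map f (downFrom (suc n)))             ≡⟨ cong (sum ∘ map f) (reverse-upTo (suc n)) ⟨
  sum (map f (reverse (upTo (suc n))))       ≡⟨ cong sum (reverse-map f (upTo (suc n))) ⟩
  sum (reverse (map f (upTo (suc n))))       ≡⟨ sum-↭ (↭-reverse (map f (upTo (suc n)))) ⟩
  Σ< (suc n) f                               ∎

Σ<-binomial-reflect : ∀ n (q : ℕ → ℕ) →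
  Σ< (suc n) (λ w → (n C w) * q (n ∸ w)) ≡ q n + Σ< n (λ s → (n C s) * q s)
Σ<-binomial-reflect n q = begin
  Σ< (suc n) (λ w → (n C w) * q (n ∸ w))
    ≡⟨ Σ<-cong (suc n) (λ {i} i<1+n → cong (_* q (n ∸ i)) (nCk≡nC[n∸k] (s≤s⁻¹ i<1+n))) ⟩
  Σ< (suc n) (λ w → (n C (n ∸ w)) * q (n ∸ w))
    ≡⟨ Σ<-reflect n (λ s → (n C s) * q s) ⟩
  Σ< (suc n) (λ s → (n C s) * q s)
    ≡⟨ Σ<-suc n (λ s → (n C s) * q s) ⟩
  Σ< n (λ s → (n C s) * q s) + (n C n) * q n
    ≡⟨ cong (Σ< n (λ s → (n C s) * q s) +_) (trans (cong (_* q n) (nCn≡1 n)) (*-identityˡ (q n))) ⟩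
  Σ< n (λ s → (n C s) * q s) + q n
    ≡⟨ +-comm _ (q n) ⟩
  q n + Σ< n (λ s → (n C s) * q s)
    ∎

nCk*k!*[n∸k]!≡n! : ∀ {n k} → k ≤ n → (n C k) * (k ! * (n ∸ k) !) ≡ n !
nCk*k!*[n∸k]!≡n! {n} {k} k≤n =
  trans (cong (_* (k ! * (n ∸ k) !)) (nCk≡n!/k![n-k]! k≤n))
        (m/n*n≡m {{k !* (n ∸ k) !≢0}} (k![n∸k]!∣n! k≤n))

prod!∣sum! : ∀ ws → prod! ws ∣ (sum ws) !
prod!∣sum! []       = 1∣ 1
prod!∣sum! (w ∷ ws) = ∣-trans (*-monoʳ-∣ (w !) (prod!∣sum! ws)) w!*s!∣[w+s]!
  where
  w!*s!∣[w+s]! : w ! * (sum ws) ! ∣ (w + sum ws) !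
  w!*s!∣[w+s]! = subst (λ s → w ! * s ! ∣ (w + sum ws) !) (m+n∸m≡n w (sum ws))
                       (k![n∸k]!∣n! (m≤m+n w (sum ws)))

multinomial*prod!≡n! : ∀ {n} ws → sum ws ≡ n → multinomial n ws * prod! ws ≡ n !
multinomial*prod!≡n! ws refl = m/n*n≡m {{prod!≢0 ws}} (prod!∣sum! ws)

multinomial-∷ : ∀ {n w} ws → w ≤ n → sum ws ≡ n ∸ w →
  multinomial n (w ∷ ws) ≡ (n C w) * multinomial (n ∸ w) ws
multinomial-∷ {n} {w} ws w≤n Σws≡n∸w =
  *-cancelʳ-≡ _ _ (prod! (w ∷ ws)) {{prod!≢0 (w ∷ ws)}} (begin
  multinomial n (w ∷ ws) * (w ! * prod! ws)
    ≡⟨ multinomial*prod!≡n! (w ∷ ws) (trans (cong (w +_) Σws≡n∸w) (m+[n∸m]≡n w≤n)) ⟩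
  n !
    ≡⟨ nCk*k!*[n∸k]!≡n! w≤n ⟨
  (n C w) * (w ! * (n ∸ w) !)
    ≡⟨ cong (λ x → (n C w) * (w ! * x)) (multinomial*prod!≡n! ws Σws≡n∸w) ⟨
  (n C w) * (w ! * (multinomial (n ∸ w) ws * prod! ws))
    ≡⟨ interchange (n C w) (w !) (multinomial (n ∸ w) ws) (prod! ws) ⟩
  (n C w) * multinomial (n ∸ w) ws * (w ! * prod! ws)
    ∎)
  where
  interchange : ∀ a b c d → a * (b * (c * d)) ≡ a * c * (b * d)
  interchange = solve-∀

sum-∈-compositions : ∀ m n {ws} → ws ∈ compositions m n → sum ws ≡ n
sum-∈-compositions zero    zero    (here refl) = refl
sum-∈-compositions (suc m) n       ws∈
  with w , w∈ , ws∈map ← find (∈-concatMap⁻ (λ w → map (w ∷_) (compositions m (n ∸ w))) {upTo (suc n)} ws∈)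
  with vs , vs∈ , refl ← ∈-map⁻ (w ∷_) ws∈map
  = trans (cong (w +_) (sum-∈-compositions m (n ∸ w) vs∈)) (m+[n∸m]≡n (s≤s⁻¹ (∈-upTo⁻ w∈)))

p-suc : ∀ r j n → p (suc r) j n ≡ Σ< (suc n) (λ w → (n C w) * p r j (n ∸ w))
p-suc r j n = begin
  p (suc r) j n
    ≡⟨ sum-map-concatMap (summand (suc r) n) first-section-of-size (upTo (suc n)) ⟩
  Σ< (suc n) (λ w → sum (map (summand (suc r) n) (first-section-of-size w)))
    ≡⟨ Σ<-cong (suc n) (λ w<1+n → first-section (s≤s⁻¹ w<1+n)) ⟩
  Σ< (suc n) (λ w → (n C w) * p r j (n ∸ w))
    ∎
  where
  summand : ℕ → ℕ → List ℕ → ℕ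
  summand k m ws = multinomial m ws * product (map a (drop k ws))

  first-section-of-size : ℕ → List (List ℕ)
  first-section-of-size w = map (w ∷_) (compositions (r + j) (n ∸ w))

  first-section : ∀ {w} → w ≤ n →
    sum (map (summand (suc r) n) (first-section-of-size w)) ≡ (n C w) * p r j (n ∸ w)
  first-section {w} w≤n = begin
    sum (map (summand (suc r) n) (map (w ∷_) cs))        ≡⟨ cong sum (map-∘ cs) ⟨
    sum (map (summand (suc r) n ∘ (w ∷_)) cs)            ≡⟨ sum-map-cong-∈ summand-∷ ⟩
    sum (map (λ ws → (n C w) * summand r (n ∸ w) ws) cs) ≡⟨ sum-map-*ˡ (n C w) (summand r (n ∸ w)) cs ⟩
    (n C w) * p r j (n ∸ w)                              ∎
    where
    cs : List (List ℕ)
    cs = compositions (r + j) (n ∸ w)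

    summand-∷ : ∀ {ws} → ws ∈ cs → summand (suc r) n (w ∷ ws) ≡ (n C w) * summand r (n ∸ w) ws
    summand-∷ {ws} ws∈cs = begin
      multinomial n (w ∷ ws) * product (map a (drop r ws))
        ≡⟨ cong (_* product (map a (drop r ws)))
                (multinomial-∷ ws w≤n (sum-∈-compositions (r + j) (n ∸ w) ws∈cs)) ⟩
      (n C w) * multinomial (n ∸ w) ws * product (map a (drop r ws))
        ≡⟨ *-assoc (n C w) (multinomial (n ∸ w) ws) _ ⟩
      (n C w) * summand r (n ∸ w) ws
        ∎

theorem8 : (n r j : ℕ) → 1 ≤ n → 1 ≤ r → 1 ≤ j →
    p r j n ≡ p (r ∸ 1) j n + Σ< n (λ s → (n C s) * p (r ∸ 1) j s)
theorem8 n (suc r) j _ _ _ = trans (p-suc r j n) (Σ<-binomial-reflect n (p r j))
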